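{- If $H=(V,E)$ is a nontrivial hypergraph, then $\kappa_S(H)\leq\tau(H)$.
   Context: A hypergraph $H=(V,E)$ consists of a finite vertex set $V$ and a finite multiset $E$ of edges, each a submultiset of $V$. $H$ is nontrivial if $|V|\geq2$. A path is a sequence $v_1,e_1,\dots,e_s,v_{s+1}$ of distinct vertices and distinct edges with the multiset $[v_j,v_{j+1}]\subseteq e_j$; $H$ is connected if any two vertices are joined by a path, disconnected otherwise. For $X\subseteq V$, $H\setminus_S X$ removes $X$ and every edge containing a vertex of $X$. For nontrivial $H$, $\kappa_S(H)$ is the minimum $|X|$ over $X\subseteq V$ with $H\setminus_S X$ disconnected if such $X$ exists, and $|V|-1$ otherwise. A transversal of $H$ is a set $T\subseteq V$ meeting every nonempty edge of $H$; $\tau(H)$ is the minimum size of a transversal. -}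

module Defs where

open import Data.Nat using (ℕ; zero; suc; _≤_; _<_; _∸_)
open import Data.Fin using (Fin; _≟_)
open import Data.Fin.Subset using (Subset; _∈_; _∉_; ∣_∣)
open import Data.List using (List; []; _∷_; length; lookup)
open import Data.List.Relation.Unary.Unique.Propositional using (Unique)
open import Data.Product using (Σ; _×_; ∃; _,_)
open import Data.Sum using (_⊎_)
open import Relation.Nullary using (¬_; yes; no)
open import Relation.Binary.PropositionalEquality using (_≡_)

-- An edge is a submultiset of the
-- vertex set, given by its multiplicity function Fin n → ℕ.  The multiset of
-- edges is a list (order irrelevant; repetitions allowed).
record Hypergraph : Set where
  field
    n     : ℕ
    edges : List (Fin n → ℕ)

open Hypergraph public

Edge : ℕ → Set
Edge n = Fin n → ℕ

_∈ₑ_ : ∀ {n} → Fin n → Edge n → Set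
v ∈ₑ e = 0 < e v

NonemptyEdge : ∀ {n} → Edge n → Set
NonemptyEdge {n} e = Σ (Fin n) λ v → v ∈ₑ e

Meets : ∀ {n} → Edge n → Subset n → Set
Meets {n} e X = Σ (Fin n) λ v → v ∈ₑ e × v ∈ X

mult2 : ∀ {n} → Fin n → Fin n → Fin n → ℕ
mult2 a b x with a ≟ x | b ≟ x
... | yes _ | yes _ = 2
... | yes _ | no _  = 1
... | no _  | yes _ = 1
... | no _  | no _  = 0

PairIn : ∀ {n} → Fin n → Fin n → Edge n → Set
PairIn {n} a b e = ∀ (x : Fin n) → mult2 a b x ≤ e x

-- Walks in H ∖_S X: vertices outside X, edges (referred to by their index in
-- the edge list of H) not meeting X.
data Walk (H : Hypergraph) (X : Subset (n H)) : Fin (n H) → Fin (n H) → Set where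
  stop : (v : Fin (n H)) → v ∉ X → Walk H X v v
  step : (v w u : Fin (n H)) (i : Fin (length (edges H))) →
         v ∉ X →
         ¬ Meets (lookup (edges H) i) X →
         PairIn v w (lookup (edges H) i) →
         Walk H X w u → Walk H X v u

walkVertices : ∀ {H X u v} → Walk H X u v → List (Fin (n H))
walkVertices (stop v _) = v ∷ []
walkVertices (step v _ _ _ _ _ _ p) = v ∷ walkVertices p

walkEdges : ∀ {H X u v} → Walk H X u v → List (Fin (length (edges H)))
walkEdges (stop _ _) = []
walkEdges (step _ _ _ i _ _ _ p) = i ∷ walkEdges p

Path : (H : Hypergraph) → Subset (n H) → Fin (n H) → Fin (n H) → Set
Path H X u v = Σ (Walk H X u v) λ p → Unique (walkVertices p) × Unique (walkEdges p)

ConnectedMinus : (H : Hypergraph) → Subset (n H) → Set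
ConnectedMinus H X = ∀ (u v : Fin (n H)) → u ∉ X → v ∉ X → Path H X u v

DisconnectedMinus : (H : Hypergraph) → Subset (n H) → Set
DisconnectedMinus H X = ¬ ConnectedMinus H X

Nontrivial : Hypergraph → Set
Nontrivial H = 2 ≤ n H

IsMin : (ℕ → Set) → ℕ → Set
IsMin P k = P k × (∀ m → P m → k ≤ m)

IsKappaS : Hypergraph → ℕ → Set
IsKappaS H k =
  (Σ (Subset (n H)) (λ X → DisconnectedMinus H X) ×
     IsMin (λ m → Σ (Subset (n H)) λ X → DisconnectedMinus H X × ∣ X ∣ ≡ m) k)
  ⊎ ((¬ Σ (Subset (n H)) λ X → DisconnectedMinus H X) × k ≡ (n H ∸ 1))

Transversal : (H : Hypergraph) → Subset (n H) → Set
Transversal H T = ∀ (i : Fin (length (edges H))) →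
  NonemptyEdge (lookup (edges H) i) → Meets (lookup (edges H) i) T

IsTau : Hypergraph → ℕ → Set
IsTau H t = IsMin (λ m → Σ (Subset (n H)) λ T → Transversal H T × ∣ T ∣ ≡ m) t

-- A minimum transversal T either leaves two distinct vertices u, v outside
-- it, or at most one.  In the first case T separates u from v: a path from u
-- to v starts with an edge containing u, which is nonempty and hence meets T;
-- so κ_S(H) ≤ |T| = τ(H).  In the second case τ(H) ≥ |V| − 1 ≥ κ_S(H), since
-- a disconnecting set must leave at least two vertices.
module Submission where

open import Defs
open import Data.Nat using (ℕ; suc; _≤_; _<_; _∸_; _+_; z≤n; s≤s; _≤?_)
open import Data.Nat.Base using (s≤s⁻¹)
open import Data.Nat.Properties using (m≤n⇒m≤1+n; ≰⇒>; ∸-monoˡ-≤; <⇒≤; ≤-refl; ≤-trans)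
open import Data.Fin using (Fin; zero; suc; _≟_)
open import Data.Fin.Properties using (suc-injective)
open import Data.Fin.Subset using (Subset; _∉_; ∣_∣; inside; outside)
open import Data.Fin.Subset.Properties using (∣p∣≤n; drop-not-there)
open import Data.Vec using (_∷_; here; there)
open import Data.List.Relation.Unary.AllPairs using ([]; _∷_)
open import Data.List.Relation.Unary.All using ([])
open import Data.Product using (Σ; ∃; _×_; _,_)
open import Data.Sum using (inj₁; inj₂)
open import Function using (_∘_)
open import Relation.Nullary using (¬_; yes; no; contradiction)
open import Relation.Nullary.Decidable using (decidable-stable)
open import Relation.Binary.PropositionalEquality using (_≡_; _≢_; refl; cong; subst)

private
  variable
    m : ℕ

∉⇒∣p∣<n : (p : Subset m) {x : Fin m} → x ∉ p → ∣ p ∣ < m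
∉⇒∣p∣<n (inside  ∷ p) {zero}  x∉p = contradiction here x∉p
∉⇒∣p∣<n (outside ∷ p) {zero}  x∉p = s≤s (∣p∣≤n p)
∉⇒∣p∣<n (inside  ∷ p) {suc x} x∉p = s≤s (∉⇒∣p∣<n p (drop-not-there x∉p))
∉⇒∣p∣<n (outside ∷ p) {suc x} x∉p = m≤n⇒m≤1+n (∉⇒∣p∣<n p (drop-not-there x∉p))

∉∧∉⇒2+∣p∣≤n : (p : Subset m) {x y : Fin m} → x ≢ y → x ∉ p → y ∉ p → 2 + ∣ p ∣ ≤ m
∉∧∉⇒2+∣p∣≤n (_       ∷ p) {zero}  {zero}  x≢y _   _   = contradiction refl x≢y
∉∧∉⇒2+∣p∣≤n (inside  ∷ p) {zero}  {suc y} _   x∉p _   = contradiction here x∉p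
∉∧∉⇒2+∣p∣≤n (outside ∷ p) {zero}  {suc y} _   _   y∉p = s≤s (∉⇒∣p∣<n p (drop-not-there y∉p))
∉∧∉⇒2+∣p∣≤n (inside  ∷ p) {suc x} {zero}  _   _   y∉p = contradiction here y∉p
∉∧∉⇒2+∣p∣≤n (outside ∷ p) {suc x} {zero}  _   x∉p _   = s≤s (∉⇒∣p∣<n p (drop-not-there x∉p))
∉∧∉⇒2+∣p∣≤n (inside  ∷ p) {suc x} {suc y} x≢y x∉p y∉p =
  s≤s (∉∧∉⇒2+∣p∣≤n p (x≢y ∘ cong suc) (drop-not-there x∉p) (drop-not-there y∉p))
∉∧∉⇒2+∣p∣≤n (outside ∷ p) {suc x} {suc y} x≢y x∉p y∉p =
  m≤n⇒m≤1+n (∉∧∉⇒2+∣p∣≤n p (x≢y ∘ cong suc) (drop-not-there x∉p) (drop-not-there y∉p))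

∣p∣<n⇒∃∉ : (p : Subset m) → ∣ p ∣ < m → ∃ λ x → x ∉ p
∣p∣<n⇒∃∉ (outside ∷ p) _ = zero , λ ()
∣p∣<n⇒∃∉ (inside  ∷ p) (s≤s ∣p∣<n) with ∣p∣<n⇒∃∉ p ∣p∣<n
... | x , x∉p = suc x , λ { (there x∈p) → x∉p x∈p }

2+∣p∣≤n⇒∃∉∧∉ : (p : Subset m) → 2 + ∣ p ∣ ≤ m →
  Σ (Fin m) λ x → Σ (Fin m) λ y → x ≢ y × x ∉ p × y ∉ p
2+∣p∣≤n⇒∃∉∧∉ (outside ∷ p) (s≤s 1+∣p∣≤n) with ∣p∣<n⇒∃∉ p 1+∣p∣≤n
... | y , y∉p = zero , suc y , (λ ()) , (λ ()) , λ { (there y∈p) → y∉p y∈p }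
2+∣p∣≤n⇒∃∉∧∉ (inside  ∷ p) (s≤s 2+∣p∣≤n) with 2+∣p∣≤n⇒∃∉∧∉ p 2+∣p∣≤n
... | x , y , x≢y , x∉p , y∉p =
  suc x , suc y , x≢y ∘ suc-injective ,
  (λ { (there x∈p) → x∉p x∈p }) , λ { (there y∈p) → y∉p y∈p }

pairIn⇒∈ₑ : {a b : Fin m} {e : Edge m} → PairIn a b e → a ∈ₑ e
pairIn⇒∈ₑ {a = a} {b} {e} ab⊆e = ≤-trans (a∈[a,b] a b) (ab⊆e a)
  where
  a∈[a,b] : (a b : Fin m) → 1 ≤ mult2 a b a
  a∈[a,b] a b with a ≟ a | b ≟ a
  ... | yes _   | yes _ = s≤s z≤n
  ... | yes _   | no _  = s≤s z≤n
  ... | no a≢a  | _     = contradiction refl a≢a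

transversal-separates : (H : Hypergraph) {T : Subset (n H)} → Transversal H T →
  {x y : Fin (n H)} → x ≢ y → x ∉ T → y ∉ T → DisconnectedMinus H T
transversal-separates H T-tr x≢y x∉T y∉T connected with connected _ _ x∉T y∉T
... | stop _ _ , _ = x≢y refl
... | step x _ _ i _ e∩T=∅ xw⊆e _ , _ = e∩T=∅ (T-tr i (x , pairIn⇒∈ₑ xw⊆e))

connectedMinus-if-≤1-remains : (H : Hypergraph) (X : Subset (n H)) →
  ¬ (2 + ∣ X ∣ ≤ n H) → ConnectedMinus H X
connectedMinus-if-≤1-remains H X few x y x∉X y∉X with x ≟ y
... | yes refl = stop x x∉X , ([] ∷ []) , []
... | no x≢y   = contradiction (∉∧∉⇒2+∣p∣≤n X x≢y x∉X y∉X) few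

disconnectedMinus⇒2+∣X∣≤n : (H : Hypergraph) (X : Subset (n H)) →
  DisconnectedMinus H X → 2 + ∣ X ∣ ≤ n H
disconnectedMinus⇒2+∣X∣≤n H X disconnected =
  decidable-stable (2 + ∣ X ∣ ≤? n H) (disconnected ∘ connectedMinus-if-≤1-remains H X)

isKappaS-≤-disconnecting : (H : Hypergraph) {k : ℕ} → IsKappaS H k →
  {X : Subset (n H)} → DisconnectedMinus H X → k ≤ ∣ X ∣
isKappaS-≤-disconnecting H (inj₁ (_ , _ , minimal)) {X} D = minimal ∣ X ∣ (X , D , refl)
isKappaS-≤-disconnecting H (inj₂ (none , _))        {X} D = contradiction (X , D) none

isKappaS-≤-n∸1 : (H : Hypergraph) {k : ℕ} → IsKappaS H k → k ≤ n H ∸ 1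
isKappaS-≤-n∸1 H (inj₁ (_ , (X , D , refl) , _)) =
  <⇒≤ (∸-monoˡ-≤ 1 (disconnectedMinus⇒2+∣X∣≤n H X D))
isKappaS-≤-n∸1 H (inj₂ (_ , refl)) = ≤-refl

mainTheorem6 : (H : Hypergraph) → Nontrivial H →
    (k t : ℕ) → IsKappaS H k → IsTau H t → k ≤ t
mainTheorem6 H _ k t κ ((T , T-tr , refl) , _) with 2 + ∣ T ∣ ≤? n H
... | yes two-remain with 2+∣p∣≤n⇒∃∉∧∉ T two-remain
...   | x , y , x≢y , x∉T , y∉T =
  isKappaS-≤-disconnecting H κ (transversal-separates H T-tr x≢y x∉T y∉T)
mainTheorem6 H _ k t κ ((T , T-tr , refl) , _) | no few-remain =
  ≤-trans (isKappaS-≤-n∸1 H κ) (∸-monoˡ-≤ 1 (s≤s⁻¹ (≰⇒> few-remain)))
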